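{- Let $B\in\{1,\dots,9\}$, let $\tilde p\neq0$ be an integer and $\tilde q$ a positive integer with $\tilde q\geqslant 3600\sqrt[3]{|\tilde p|}$. Let $F_3=B\tilde q^{4}-\tilde p\tilde q+\frac{16}{B}$. Then there is no integer $t$ with $F_3+\frac{32\tilde p}{B^{2}\tilde q^{3}}<t<F_3$ (case $\tilde p<0$), respectively with $F_3<t<F_3+\frac{32\tilde p}{B^{2}\tilde q^{3}}$ (case $\tilde p>0$). -}

module Defs where

open import Data.Nat as ℕ using (ℕ; NonZero; _^_)
open import Data.Nat.Properties using (m*n≢0; m^n≢0)
open import Data.Integer as ℤ using (ℤ; +_)
open import Data.Rational as ℚ using (ℚ; _/_)

F₃ : (B : ℕ) → .{{NonZero B}} → (p : ℤ) → (q : ℕ) → ℚ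
F₃ B p q = ((+ B) ℤ.* (+ (q ^ 4)) ℤ.- p ℤ.* (+ q)) / 1 ℚ.+ (+ 16) / B

δ : (B : ℕ) → .{{NonZero B}} → (p : ℤ) → (q : ℕ) → .{{NonZero q}} → ℚ
δ B p q = _/_ ((+ 32) ℤ.* p) ((B ^ 2) ℕ.* (q ^ 3))
             {{m*n≢0 (B ^ 2) (q ^ 3) {{m^n≢0 B 2}} {{m^n≢0 q 3}}}}

{-# OPTIONS --safe #-}
-- F₃ is a fraction a / B with a ∈ ℤ.  If an integer t lay strictly between a / B and
-- a / B + c / d (c = 32 p̃, d = B² q̃³), then |t B − a| ≥ 1, and clearing denominators
-- gives d < |c| B, i.e. B q̃³ < 32 |p̃|; but 32 |p̃| ≤ 3600³ |p̃| ≤ q̃³.  So δ is too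
-- small to reach the next multiple of 1 / B.
module Submission where

open import Defs
open import Data.Nat as ℕ using (ℕ; NonZero; _^_)
import Data.Nat.Properties as ℕP
open import Data.Integer as ℤ using (ℤ; +_; -[1+_]; ∣_∣; 0ℤ; 1ℤ; -_; _*_; _+_; _-_; _<_)
import Data.Integer.Properties as ℤP
open import Data.Integer.Tactic.RingSolver using (solve)
open import Data.Rational as ℚ using (_/_; toℚᵘ)
import Data.Rational.Properties as ℚP
import Data.Rational.Unnormalised as ℚᵘ
import Data.Rational.Unnormalised.Properties as ℚᵘP
open import Data.List using ([]; _∷_)
open import Data.Product using (∃; _×_; _,_)
open import Relation.Nullary using (¬_)
open import Relation.Binary.PropositionalEquality
open import Data.Unit using (tt)

toℚᵘ-/ : ∀ i n .{{_ : NonZero n}} → toℚᵘ (i / n) ℚᵘ.≃ (i ℚᵘ./ n)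
toℚᵘ-/ i (ℕ.suc n) = ℚP.toℚᵘ-fromℚᵘ (ℚᵘ.mkℚᵘ i n)

/<\/⇒*<* : ∀ i m j n .{{_ : NonZero m}} .{{_ : NonZero n}} → i / m ℚ.< j / n → i * + n < j * + m
/<\/⇒*<* i m@(ℕ.suc _) j n@(ℕ.suc _) i/m<j/n
  with ℚᵘ.*<* i*n<j*m ← ℚᵘP.<-respˡ-≃ (toℚᵘ-/ i m) (ℚᵘP.<-respʳ-≃ (toℚᵘ-/ j n) (ℚP.toℚᵘ-mono-< i/m<j/n))
  = i*n<j*m

/-+-/ : ∀ i m j n .{{_ : NonZero m}} .{{_ : NonZero n}} →
        i / m ℚ.+ j / n ≡ _/_ (i * + n + j * + m) (m ℕ.* n) {{ℕP.m*n≢0 m n}}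
/-+-/ i m@(ℕ.suc _) j n@(ℕ.suc _) = ℚP.toℚᵘ-injective (begin-equality
  toℚᵘ (i / m ℚ.+ j / n)                  ≃⟨ ℚP.toℚᵘ-homo-+ (i / m) (j / n) ⟩
  toℚᵘ (i / m) ℚᵘ.+ toℚᵘ (j / n)          ≃⟨ ℚᵘP.+-cong (toℚᵘ-/ i m) (toℚᵘ-/ j n) ⟩
  (i ℚᵘ./ m) ℚᵘ.+ (j ℚᵘ./ n)              ≃⟨ ℚᵘP.≃-sym (toℚᵘ-/ (i * + n + j * + m) (m ℕ.* n)) ⟩
  toℚᵘ ((i * + n + j * + m) / (m ℕ.* n))  ∎)
  where open ℚᵘP.≤-Reasoning

cross-gap-above : ∀ a b c d t → .{{_ : ℤ.NonNegative d}} →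
                  a < t * b → t * b * d < a * d + c * b → d < c * b
cross-gap-above a b c d t a<tb tbd<ad+cb = begin-strict
  d                      ≡⟨ solve (a ∷ d ∷ []) ⟩
  (1ℤ + a) * d - a * d   ≤⟨ ℤP.+-monoˡ-≤ (- (a * d)) (ℤP.*-monoʳ-≤-nonNeg d (ℤP.i<j⇒suc[i]≤j a<tb)) ⟩
  t * b * d - a * d      <⟨ ℤP.+-monoˡ-< (- (a * d)) tbd<ad+cb ⟩
  a * d + c * b - a * d  ≡⟨ solve (a ∷ b ∷ c ∷ d ∷ []) ⟩
  c * b                  ∎
  where open ℤP.≤-Reasoning

cross-gap-below : ∀ a b c d t → .{{_ : ℤ.NonNegative d}} →
                  a * d + c * b < t * b * d → t * b < a → d < - c * b
cross-gap-below a b c d t ad+cb<tbd tb<a = begin-strict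
  d                              ≡⟨ solve (b ∷ d ∷ t ∷ []) ⟩
  (1ℤ + t * b) * d - t * b * d   ≤⟨ ℤP.+-monoˡ-≤ (- (t * b * d)) (ℤP.*-monoʳ-≤-nonNeg d (ℤP.i<j⇒suc[i]≤j tb<a)) ⟩
  a * d - t * b * d              <⟨ ℤP.+-monoʳ-< (a * d) (ℤP.neg-mono-< ad+cb<tbd) ⟩
  a * d - (a * d + c * b)        ≡⟨ solve (a ∷ b ∷ c ∷ d ∷ []) ⟩
  - c * b                        ∎
  where open ℤP.≤-Reasoning

i*+[m*n]≡i*+m*+n : ∀ i m n → i * + (m ℕ.* n) ≡ i * + m * + n
i*+[m*n]≡i*+m*+n i m n = trans (cong (i *_) (ℤP.pos-* m n)) (sym (ℤP.*-assoc i (+ m) (+ n)))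

integer-in-gap-above : ∀ a b c d t .{{_ : NonZero b}} .{{_ : NonZero d}} →
                       a / b ℚ.< t / 1 → t / 1 ℚ.< a / b ℚ.+ c / d → + d < c * + b
integer-in-gap-above a b c d t a/b<t t<a/b+c/d =
  cross-gap-above a (+ b) c (+ d) t
    (subst (_< t * + b) (ℤP.*-identityʳ a) (/<\/⇒*<* a b t 1 a/b<t))
    (subst₂ _<_ (i*+[m*n]≡i*+m*+n t b d) (ℤP.*-identityʳ _)
       (/<\/⇒*<* t 1 (a * + d + c * + b) (b ℕ.* d) {{_}} {{ℕP.m*n≢0 b d}}
          (subst (t / 1 ℚ.<_) (/-+-/ a b c d) t<a/b+c/d)))

integer-in-gap-below : ∀ a b c d t .{{_ : NonZero b}} .{{_ : NonZero d}} →
                       a / b ℚ.+ c / d ℚ.< t / 1 → t / 1 ℚ.< a / b → + d < - c * + b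
integer-in-gap-below a b c d t a/b+c/d<t t<a/b =
  cross-gap-below a (+ b) c (+ d) t
    (subst₂ _<_ (ℤP.*-identityʳ _) (i*+[m*n]≡i*+m*+n t b d)
       (/<\/⇒*<* (a * + d + c * + b) (b ℕ.* d) t 1 {{ℕP.m*n≢0 b d}}
          (subst (ℚ._< t / 1) (/-+-/ a b c d) a/b+c/d<t)))
    (subst (t * + b <_) (ℤP.*-identityʳ a) (/<\/⇒*<* t 1 a b t<a/b))

+[m*∣i∣]≡+m*i : ∀ m {i} → 0ℤ < i → + (m ℕ.* ∣ i ∣) ≡ + m * i
+[m*∣i∣]≡+m*i m {+ n} _ = ℤP.pos-* m n
+[m*∣i∣]≡+m*i m { -[1+ n ]} ()

+[m*∣i∣]≡-[+m*i] : ∀ m {i} → i < 0ℤ → + (m ℕ.* ∣ i ∣) ≡ - (+ m * i)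
+[m*∣i∣]≡-[+m*i] m { -[1+ n ]} _ = trans (ℤP.pos-* m (ℕ.suc n)) (sym (ℤP.neg-distribʳ-* (+ m) -[1+ n ]))
+[m*∣i∣]≡-[+m*i] m {+ n} (ℤ.+<+ ())

32*m*B≤B^2*q^3 : ∀ k m B q .{{_ : NonZero B}} →
                 32 ℕ.≤ k → k ℕ.* m ℕ.≤ q ^ 3 → 32 ℕ.* m ℕ.* B ℕ.≤ B ^ 2 ℕ.* q ^ 3
32*m*B≤B^2*q^3 k m B q 32≤k km≤q³ = begin
  32 ℕ.* m ℕ.* B      ≤⟨ ℕP.*-monoˡ-≤ B (ℕP.*-monoˡ-≤ m 32≤k) ⟩
  k ℕ.* m ℕ.* B       ≤⟨ ℕP.*-monoˡ-≤ B km≤q³ ⟩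
  q ^ 3 ℕ.* B         ≤⟨ ℕP.m≤n*m (q ^ 3 ℕ.* B) B ⟩
  B ℕ.* (q ^ 3 ℕ.* B) ≡⟨ reorder B (q ^ 3) ⟩
  B ^ 2 ℕ.* q ^ 3     ∎
  where
  open ℕP.≤-Reasoning
  reorder : ∀ x y → x ℕ.* (y ℕ.* x) ≡ x ^ 2 ℕ.* y
  reorder x y = trans (cong (x ℕ.*_) (ℕP.*-comm y x))
    (trans (sym (ℕP.*-assoc x x y)) (cong (λ z → x ℕ.* z ℕ.* y) (sym (ℕP.*-identityʳ x))))

theorem7p9 : (B : ℕ) → .{{_ : NonZero B}} → B ℕ.≤ 9 →
    (p : ℤ) → p ≢ ℤ.0ℤ →
    (q : ℕ) → .{{_ : NonZero q}} →
    (3600 ^ 3) ℕ.* ∣ p ∣ ℕ.≤ q ^ 3 →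
    (p ℤ.< ℤ.0ℤ → ¬ (∃ λ (t : ℤ) → (F₃ B p q ℚ.+ δ B p q ℚ.< t / 1) × (t / 1 ℚ.< F₃ B p q))) ×
    (ℤ.0ℤ ℤ.< p → ¬ (∃ λ (t : ℤ) → (F₃ B p q ℚ.< t / 1) × (t / 1 ℚ.< F₃ B p q ℚ.+ δ B p q)))
theorem7p9 B _ p _ q 3600³∣p∣≤q³ = no-integer-below , no-integer-above
  where
  N : ℤ
  N = + B * + (q ^ 4) - p * + q

  a : ℤ
  a = N * + B + + 16

  D : ℕ
  D = B ^ 2 ℕ.* q ^ 3

  instance
    D≢0 : NonZero D
    D≢0 = ℕP.m*n≢0 (B ^ 2) (q ^ 3) {{ℕP.m^n≢0 B 2}} {{ℕP.m^n≢0 q 3}}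

  F₃≡a/B : F₃ B p q ≡ a / B
  F₃≡a/B = trans (/-+-/ N 1 (+ 16) B)
    (ℚP./-cong {{ℕP.m*n≢0 1 B}} (cong (λ x → N * + B + x) (ℤP.*-identityʳ (+ 16))) (ℕP.*-identityˡ B))

  D≮32∣p∣B : ¬ (+ D < + (32 ℕ.* ∣ p ∣) * + B)
  D≮32∣p∣B D<32∣p∣B = ℕP.<⇒≱ (ℤP.drop‿+<+ (subst (+ D <_) (sym (ℤP.pos-* (32 ℕ.* ∣ p ∣) B)) D<32∣p∣B))
    (32*m*B≤B^2*q^3 (3600 ^ 3) ∣ p ∣ B q (ℕP.≤ᵇ⇒≤ 32 (3600 ^ 3) tt) 3600³∣p∣≤q³)

  no-integer-below : p < 0ℤ → ¬ (∃ λ t → (F₃ B p q ℚ.+ δ B p q ℚ.< t / 1) × (t / 1 ℚ.< F₃ B p q))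
  no-integer-below p<0 (t , F₃+δ<t , t<F₃) = D≮32∣p∣B
    (subst (λ c → + D < c * + B) (sym (+[m*∣i∣]≡-[+m*i] 32 p<0))
      (integer-in-gap-below a B (+ 32 * p) D t
        (subst (λ x → x ℚ.+ δ B p q ℚ.< t / 1) F₃≡a/B F₃+δ<t) (subst (t / 1 ℚ.<_) F₃≡a/B t<F₃)))

  no-integer-above : 0ℤ < p → ¬ (∃ λ t → (F₃ B p q ℚ.< t / 1) × (t / 1 ℚ.< F₃ B p q ℚ.+ δ B p q))
  no-integer-above 0<p (t , F₃<t , t<F₃+δ) = D≮32∣p∣B
    (subst (λ c → + D < c * + B) (sym (+[m*∣i∣]≡+m*i 32 0<p))
      (integer-in-gap-above a B (+ 32 * p) D t
        (subst (ℚ._< t / 1) F₃≡a/B F₃<t) (subst (λ x → t / 1 ℚ.< x ℚ.+ δ B p q) F₃≡a/B t<F₃+δ)))
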